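{- There exist a field $K$, a ring endomorphism $\varphi$ of $K$, and a valued $K[t;\varphi]$-module which is divisible but not henselian.
   Context: $K[t;\varphi]$: finite sums $\sum_it^ia_i$ ($a_i\in K$), termwise addition, multiplication via $at=t\varphi(a)$. Right modules, action $x.r$; divisible: $M.r=M$ for every non-zero $r$. Separable polynomial: $\sum_it^ia_i$ with $a_0\ne0$. A $\tau$-chain: linear order $\Delta$ with maximum $\infty$, strictly increasing $\tau:\Delta\to\Delta$ with $\tau(\infty)=\infty$, such that for all $\gamma\ne\infty$, $\delta$: $\tau(\gamma)\le\gamma\wedge\delta<\gamma\Rightarrow\tau(\delta)<\delta$. "$v(x)>\theta$" means $\tau(v(x))>v(x)$ or $v(x)=\infty$. A valued $K[t;\varphi]$-module $(M,v)$: right module $M$ with surjection $v:M\to\Delta$ onto a $\tau$-chain, $v(x)=\infty\iff x=0$, $v(x\pm y)\ge\min\{v(x),v(y)\}$, $x\mapsto x.t$ injective, $v(x.\lambda)=v(x)$ for $\lambda\in K^\times$, $v(x.t)=\tau(v(x))$. It is henselian if for every separable $r$ and every $x$ with $v(x)>\theta$ there is $y$ with $v(y)>\theta$ and $y.r=x$. -}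

module Defs where

open import Level using (Level; _⊔_; 0ℓ) renaming (suc to lsuc)
open import Algebra.Bundles using (CommutativeRing)
open import Algebra.Module.Bundles using (RightModule)
open import Algebra.Morphism.Structures using (module RingMorphisms)
open import Relation.Binary.Bundles using (TotalOrder)
open import Data.Product using (Σ; ∃; _×_; _,_)
open import Data.Sum using (_⊎_)
open import Data.Empty using (⊥)
open import Data.List using (List; []; _∷_)
open import Data.List.Relation.Unary.Any using (Any)
open import Relation.Nullary using (¬_)

record Field (c ℓ : Level) : Set (lsuc (c ⊔ ℓ)) where
  field
    commutativeRing : CommutativeRing c ℓ
  open CommutativeRing commutativeRing public
  field
    0≉1     : ¬ (0# ≈ 1#)
    inverse : ∀ x → ¬ (x ≈ 0#) → ∃ λ y → (x * y) ≈ 1#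

Endomorphism : ∀ {c ℓ} → Field c ℓ → Set (c ⊔ ℓ)
Endomorphism K =
  Σ (Carrier → Carrier) (RingMorphisms.IsRingHomomorphism rawRing rawRing)
  where open Field K

-- Right modules over the skew polynomial ring K[t;φ] (with a t = t φ(a)).
-- Such a module is a right K-module M together with an additive,
-- congruent map x ↦ x.t such that (x.a).t = (x.t).φ(a)
-- (this is the relation x.(a t) = x.(t φ(a))).

module _ {c ℓ : Level} (K : Field c ℓ) (φ : Endomorphism K) where
  open Field K
  private
    φf = Data.Product.proj₁ φ

  record SkewModule (m ℓm : Level) : Set (c ⊔ ℓ ⊔ lsuc (m ⊔ ℓm)) where
    field
      kmodule : RightModule ring m ℓm
    open RightModule kmodule public
    field
      _·t      : Carrierᴹ → Carrierᴹ
      ·t-cong  : ∀ {x y} → x ≈ᴹ y → (x ·t) ≈ᴹ (y ·t)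
      ·t-+     : ∀ x y → ((x +ᴹ y) ·t) ≈ᴹ ((x ·t) +ᴹ (y ·t))
      ·t-twist : ∀ x a → ((x *ᵣ a) ·t) ≈ᴹ ((x ·t) *ᵣ φf a)

    -- Skew polynomials Σ_i t^i a_i are represented by their coefficient
    -- lists (a_0 ∷ a_1 ∷ …).  Action:  x.(Σ t^i a_i) = Σ (x.t^i).a_i.
    _·_ : Carrierᴹ → List Carrier → Carrierᴹ
    x · []       = 0ᴹ
    x · (a ∷ as) = (x *ᵣ a) +ᴹ ((x ·t) · as)

  NonZeroPoly : List Carrier → Set (c ⊔ ℓ)
  NonZeroPoly r = Any (λ a → ¬ (a ≈ 0#)) r

  Separable : List Carrier → Set ℓ
  Separable []      = Level.Lift ℓ ⊥
  Separable (a ∷ _) = ¬ (a ≈ 0#)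

record TauChain (d ℓ₁ ℓ₂ : Level) : Set (lsuc (d ⊔ ℓ₁ ⊔ ℓ₂)) where
  field
    order : TotalOrder d ℓ₁ ℓ₂
  open TotalOrder order public

  _<_ : Carrier → Carrier → Set (ℓ₁ ⊔ ℓ₂)
  γ < δ = (γ ≤ δ) × ¬ (γ ≈ δ)

  field
    ∞       : Carrier
    ∞-max   : ∀ γ → γ ≤ ∞
    τ       : Carrier → Carrier
    τ-cong  : ∀ {γ δ} → γ ≈ δ → τ γ ≈ τ δ
    τ-mono  : ∀ {γ δ} → γ < δ → τ γ < τ δ
    τ-∞     : τ ∞ ≈ ∞
    τ-chain : ∀ γ δ → ¬ (γ ≈ ∞) → τ γ ≤ γ → δ < γ → τ δ < δ

module _ {c ℓ : Level} (K : Field c ℓ) (φ : Endomorphism K) where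
  open Field K

  record ValuedModule (m ℓm d ℓ₁ ℓ₂ : Level)
         : Set (c ⊔ ℓ ⊔ lsuc (m ⊔ ℓm ⊔ d ⊔ ℓ₁ ⊔ ℓ₂)) where
    field
      module′ : SkewModule K φ m ℓm
      chain   : TauChain d ℓ₁ ℓ₂
    open SkewModule module′ public
    open TauChain chain public
      renaming (Carrier to Δ; _≈_ to _≈Δ_; _≤_ to _≤Δ_; _<_ to _<Δ_)
    field
      v           : Carrierᴹ → Δ
      v-cong      : ∀ {x y} → x ≈ᴹ y → v x ≈Δ v y
      v-surj      : ∀ γ → ∃ λ x → v x ≈Δ γ
      v-∞⇒0       : ∀ x → v x ≈Δ ∞ → x ≈ᴹ 0ᴹ
      0⇒v-∞       : ∀ x → x ≈ᴹ 0ᴹ → v x ≈Δ ∞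
      v-+         : ∀ x y → (v x ≤Δ v (x +ᴹ y)) ⊎ (v y ≤Δ v (x +ᴹ y))
      v--         : ∀ x y → (v x ≤Δ v (x +ᴹ (-ᴹ y))) ⊎ (v y ≤Δ v (x +ᴹ (-ᴹ y)))
      ·t-injective : ∀ {x y} → (x ·t) ≈ᴹ (y ·t) → x ≈ᴹ y
      v-scalar    : ∀ x a → ¬ (a ≈ 0#) → v (x *ᵣ a) ≈Δ v x
      v-t         : ∀ x → v (x ·t) ≈Δ τ (v x)

    -- "v(x) > θ"
    _>θ : Carrierᴹ → Set (ℓ₁ ⊔ ℓ₂)
    x >θ = (v x <Δ τ (v x)) ⊎ (v x ≈Δ ∞)

    Divisible : Set (c ⊔ ℓ ⊔ m ⊔ ℓm)
    Divisible = ∀ r → NonZeroPoly K φ r → ∀ x → ∃ λ y → (y · r) ≈ᴹ x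

    Henselian : Set (c ⊔ ℓ ⊔ m ⊔ ℓm ⊔ ℓ₁ ⊔ ℓ₂)
    Henselian = ∀ r → Separable K φ r → ∀ x → x >θ →
                ∃ λ y → (y >θ) × ((y · r) ≈ᴹ x)

-- Take K = 𝔽₂, φ = id and M = 𝔽₂(t) with t acting by multiplication. M is a field, hence
-- divisible. A non-zero x is valued by its t-adic order when x has no pole at t = 1, and by
-- an extra bottom element ⊥ otherwise; τ adds 1 to the integer values and fixes ⊥ and ∞.
-- Now 1 + t is separable and v(1) = 0 > θ, but the only y with y (1 + t) = 1 is 1 / (1 + t),
-- which has a pole at 1, so v(y) = ⊥ is not > θ.

module Submission where

open import Defs
open import Level using (0ℓ)
open import Algebra.Bundles using (CommutativeRing; AbelianGroup)
open import Algebra.Module.Bundles using (RightModule)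
import Algebra.Morphism.Construct.Identity as Identity
import Algebra.Properties.CommutativeSemigroup as CommutativeSemigroupProperties
open import Algebra.Structures using (IsAbelianGroup)
open import Data.Bool using (Bool; true; false; _xor_; _∧_)
open import Data.Bool.Properties
  using (xor-assoc; xor-comm; xor-identityʳ; xor-same; xor-∧-commutativeRing)
open import Data.Empty using (⊥; ⊥-elim)
open import Data.Integer as ℤ using (ℤ; +_; _⊖_; 0ℤ)
import Data.Integer.Properties as ℤ
open import Data.List using (List; []; _∷_)
open import Data.List.Relation.Unary.Any using (here; there)
open import Data.Maybe using (nothing)
open import Data.Nat using (ℕ; zero; suc; _+_; _≤_; z≤n; s≤s)
import Data.Nat.Properties as ℕ
open import Data.Product using (Σ; _×_; _,_; proj₁; proj₂)
open import Data.Sum as Sum using (_⊎_; inj₁; inj₂)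
open import Relation.Binary.Bundles using (Setoid)
import Relation.Binary.Construct.Add.Extrema.NonStrict as AddExtrema
open import Relation.Binary.PropositionalEquality as ≡ using (_≡_; refl)
import Relation.Binary.Reasoning.Setoid as SetoidReasoning
open import Relation.Nullary using (¬_; yes; no)
open import Relation.Nullary.Construct.Add.Extrema using (_±; ⊥±; ⊤±; [_])
open import Tactic.RingSolver using (solve-∀; solve)
open import Tactic.RingSolver.Core.AlmostCommutativeRing
  using (AlmostCommutativeRing; fromCommutativeRing)

open AddExtrema ℤ._≤_
  using (_≤±_; ⊥±≤_; _≤⊤±; [_]≤⊤±; ⊤±≤⊤±; ≤±-reflexive-≡; ≤±-antisym-≡; ≤±-isTotalOrder-≡)
  renaming ([_] to [≤_])

-- Polynomials over 𝔽₂

Poly : Set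
Poly = List Bool

coeff : Poly → ℕ → Bool
coeff []      _       = false
coeff (a ∷ p) zero    = a
coeff (a ∷ p) (suc n) = coeff p n

infix 4 _≈_
record _≈_ (p q : Poly) : Set where
  constructor coeffwise
  field at : ∀ n → coeff p n ≡ coeff q n
open _≈_

≈-refl : ∀ {p} → p ≈ p
≈-refl = coeffwise λ _ → refl

≈-sym : ∀ {p q} → p ≈ q → q ≈ p
≈-sym e = coeffwise λ n → ≡.sym (at e n)

≈-trans : ∀ {p q r} → p ≈ q → q ≈ r → p ≈ r
≈-trans e f = coeffwise λ n → ≡.trans (at e n) (at f n)

≈-setoid : Setoid 0ℓ 0ℓ
≈-setoid = record
  { Carrier = Poly ; _≈_ = _≈_
  ; isEquivalence = record { refl = ≈-refl ; sym = ≈-sym ; trans = ≈-trans } }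

∷-cong : ∀ {a b p q} → a ≡ b → p ≈ q → a ∷ p ≈ b ∷ q
∷-cong e f = coeffwise λ { zero → e ; (suc n) → at f n }

∷-injectiveʳ : ∀ {a b p q} → a ∷ p ≈ b ∷ q → p ≈ q
∷-injectiveʳ e = coeffwise λ n → at e (suc n)

0ₚ 1ₚ : Poly
0ₚ = []
1ₚ = true ∷ []

false∷0≈0 : false ∷ 0ₚ ≈ 0ₚ
false∷0≈0 = coeffwise λ { zero → refl ; (suc n) → refl }

infixl 6 _+ₚ_
_+ₚ_ : Poly → Poly → Poly
[]      +ₚ q       = q
(a ∷ p) +ₚ []      = a ∷ p
(a ∷ p) +ₚ (b ∷ q) = (a xor b) ∷ (p +ₚ q)

coeff-+ₚ : ∀ p q n → coeff (p +ₚ q) n ≡ coeff p n xor coeff q n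
coeff-+ₚ []      q       n       = refl
coeff-+ₚ (a ∷ p) []      zero    = ≡.sym (xor-identityʳ a)
coeff-+ₚ (a ∷ p) []      (suc n) = ≡.sym (xor-identityʳ _)
coeff-+ₚ (a ∷ p) (b ∷ q) zero    = refl
coeff-+ₚ (a ∷ p) (b ∷ q) (suc n) = coeff-+ₚ p q n

+ₚ-isAbelianGroup : IsAbelianGroup _≈_ _+ₚ_ 0ₚ (λ p → p)
+ₚ-isAbelianGroup = record
  { isGroup = record
    { isMonoid = record
      { isSemigroup = record
        { isMagma = record
          { isEquivalence = Setoid.isEquivalence ≈-setoid
          ; ∙-cong = λ {p} {p′} {q} {q′} e f → coeffwise λ n → begin
              coeff (p +ₚ q) n             ≡⟨ coeff-+ₚ p q n ⟩
              coeff p n xor coeff q n      ≡⟨ ≡.cong₂ _xor_ (at e n) (at f n) ⟩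
              coeff p′ n xor coeff q′ n    ≡⟨ coeff-+ₚ p′ q′ n ⟨
              coeff (p′ +ₚ q′) n           ∎ }
        ; assoc = λ p q r → coeffwise λ n → begin
            coeff (p +ₚ q +ₚ r) n                         ≡⟨ coeff-+ₚ (p +ₚ q) r n ⟩
            coeff (p +ₚ q) n xor coeff r n                ≡⟨ ≡.cong (_xor coeff r n) (coeff-+ₚ p q n) ⟩
            (coeff p n xor coeff q n) xor coeff r n       ≡⟨ xor-assoc (coeff p n) _ _ ⟩
            coeff p n xor (coeff q n xor coeff r n)       ≡⟨ ≡.cong (coeff p n xor_) (coeff-+ₚ q r n) ⟨
            coeff p n xor coeff (q +ₚ r) n                ≡⟨ coeff-+ₚ p (q +ₚ r) n ⟨
            coeff (p +ₚ (q +ₚ r)) n                       ∎ }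
      ; identity = (λ p → ≈-refl)
                 , (λ p → coeffwise λ n → ≡.trans (coeff-+ₚ p [] n) (xor-identityʳ _)) }
    ; inverse = self-inverse , self-inverse
    ; ⁻¹-cong = λ e → e }
  ; comm = λ p q → coeffwise λ n → begin
      coeff (p +ₚ q) n          ≡⟨ coeff-+ₚ p q n ⟩
      coeff p n xor coeff q n   ≡⟨ xor-comm (coeff p n) _ ⟩
      coeff q n xor coeff p n   ≡⟨ coeff-+ₚ q p n ⟨
      coeff (q +ₚ p) n          ∎ }
  where
  open ≡.≡-Reasoning
  self-inverse : ∀ p → p +ₚ p ≈ 0ₚ
  self-inverse p = coeffwise λ n → ≡.trans (coeff-+ₚ p p n) (xor-same (coeff p n))

+ₚ-abelianGroup : AbelianGroup 0ℓ 0ℓ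
+ₚ-abelianGroup = record { isAbelianGroup = +ₚ-isAbelianGroup }

open AbelianGroup +ₚ-abelianGroup public
  using ()
  renaming ( ∙-cong to +ₚ-cong; assoc to +ₚ-assoc; comm to +ₚ-comm
           ; identityʳ to +ₚ-identityʳ; inverseʳ to +ₚ-self)
open CommutativeSemigroupProperties (AbelianGroup.commutativeSemigroup +ₚ-abelianGroup)
  using (interchange; x∙yz≈y∙xz)

scale : Bool → Poly → Poly
scale true  q = q
scale false q = 0ₚ

scale-cong : ∀ a {q q′} → q ≈ q′ → scale a q ≈ scale a q′
scale-cong true  e = e
scale-cong false e = ≈-refl

scale-0 : ∀ a → scale a 0ₚ ≡ 0ₚ
scale-0 true  = refl
scale-0 false = refl

scale-xor : ∀ a b q → scale (a xor b) q ≈ scale a q +ₚ scale b q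
scale-xor true  true  q = ≈-sym (+ₚ-self q)
scale-xor true  false q = ≈-sym (+ₚ-identityʳ q)
scale-xor false b     q = ≈-refl

scale-+ₚ : ∀ a p q → scale a (p +ₚ q) ≈ scale a p +ₚ scale a q
scale-+ₚ true  p q = ≈-refl
scale-+ₚ false p q = ≈-refl

infixl 7 _*ₚ_
_*ₚ_ : Poly → Poly → Poly
[]      *ₚ q = 0ₚ
(a ∷ p) *ₚ q = scale a q +ₚ (false ∷ (p *ₚ q))

zero-*ₚ : ∀ p q → p ≈ 0ₚ → p *ₚ q ≈ 0ₚ
zero-*ₚ []      q e = ≈-refl
zero-*ₚ (a ∷ p) q e with at e zero
... | refl = ≈-trans (∷-cong refl (zero-*ₚ p q (∷-injectiveʳ (≈-trans e (≈-sym false∷0≈0))))) false∷0≈0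

*ₚ-zeroʳ : ∀ p → p *ₚ 0ₚ ≈ 0ₚ
*ₚ-zeroʳ []      = ≈-refl
*ₚ-zeroʳ (a ∷ p) rewrite scale-0 a = ≈-trans (∷-cong refl (*ₚ-zeroʳ p)) false∷0≈0

*ₚ-congˡ : ∀ {p p′} q → p ≈ p′ → p *ₚ q ≈ p′ *ₚ q
*ₚ-congˡ {[]}    {p′}     q e = ≈-sym (zero-*ₚ p′ q (≈-sym e))
*ₚ-congˡ {a ∷ p} {[]}     q e = zero-*ₚ (a ∷ p) q e
*ₚ-congˡ {a ∷ p} {b ∷ p′} q e with at e zero
... | refl = +ₚ-cong ≈-refl (∷-cong refl (*ₚ-congˡ q (∷-injectiveʳ e)))

*ₚ-congʳ : ∀ p {q q′} → q ≈ q′ → p *ₚ q ≈ p *ₚ q′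
*ₚ-congʳ []      e = ≈-refl
*ₚ-congʳ (a ∷ p) e = +ₚ-cong (scale-cong a e) (∷-cong refl (*ₚ-congʳ p e))

*ₚ-distribʳ : ∀ q p p′ → (p +ₚ p′) *ₚ q ≈ p *ₚ q +ₚ p′ *ₚ q
*ₚ-distribʳ q []      p′       = ≈-refl
*ₚ-distribʳ q (a ∷ p) []       = ≈-sym (+ₚ-identityʳ _)
*ₚ-distribʳ q (a ∷ p) (b ∷ p′) =
  ≈-trans (+ₚ-cong (scale-xor a b q) (∷-cong refl (*ₚ-distribʳ q p p′)))
          (interchange (scale a q) (scale b q) (false ∷ (p *ₚ q)) (false ∷ (p′ *ₚ q)))

*ₚ-distribˡ : ∀ q p p′ → q *ₚ (p +ₚ p′) ≈ q *ₚ p +ₚ q *ₚ p′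
*ₚ-distribˡ []      p p′ = ≈-refl
*ₚ-distribˡ (a ∷ q) p p′ =
  ≈-trans (+ₚ-cong (scale-+ₚ a p p′) (∷-cong refl (*ₚ-distribˡ q p p′)))
          (interchange (scale a p) (scale a p′) (false ∷ (q *ₚ p)) (false ∷ (q *ₚ p′)))

*ₚ-assoc : ∀ p q r → p *ₚ q *ₚ r ≈ p *ₚ (q *ₚ r)
*ₚ-assoc []      q r = ≈-refl
*ₚ-assoc (a ∷ p) q r =
  ≈-trans (*ₚ-distribʳ r (scale a q) (false ∷ (p *ₚ q)))
          (+ₚ-cong (scale-*ₚ a) (∷-cong refl (*ₚ-assoc p q r)))
  where
  scale-*ₚ : ∀ a → scale a q *ₚ r ≈ scale a (q *ₚ r)
  scale-*ₚ true  = ≈-refl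
  scale-*ₚ false = ≈-refl

*ₚ-∷ʳ : ∀ p b q → p *ₚ (b ∷ q) ≈ scale b p +ₚ (false ∷ (p *ₚ q))
*ₚ-∷ʳ []      b q rewrite scale-0 b = ≈-sym false∷0≈0
*ₚ-∷ʳ (a ∷ p) b q = ≈-trans (+ₚ-cong ≈-refl (∷-cong refl (*ₚ-∷ʳ p b q))) (swap a b)
  where
  swap : ∀ a b → scale a (b ∷ q) +ₚ (false ∷ (scale b p +ₚ (false ∷ (p *ₚ q))))
               ≈ scale b (a ∷ p) +ₚ (false ∷ (scale a q +ₚ (false ∷ (p *ₚ q))))
  swap true  true  = ∷-cong refl (x∙yz≈y∙xz q p (false ∷ (p *ₚ q)))
  swap true  false = ≈-refl
  swap false true  = ≈-refl
  swap false false = ≈-refl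

*ₚ-comm : ∀ p q → p *ₚ q ≈ q *ₚ p
*ₚ-comm []      q = ≈-sym (*ₚ-zeroʳ q)
*ₚ-comm (a ∷ p) q = ≈-trans (+ₚ-cong ≈-refl (∷-cong refl (*ₚ-comm p q))) (≈-sym (*ₚ-∷ʳ q a p))

*ₚ-identityˡ : ∀ p → 1ₚ *ₚ p ≈ p
*ₚ-identityˡ p = ≈-trans (+ₚ-cong (≈-refl {p}) false∷0≈0) (+ₚ-identityʳ p)

Poly-commutativeRing : CommutativeRing 0ℓ 0ℓ
Poly-commutativeRing = record
  { isCommutativeRing = record
    { isRing = record
      { +-isAbelianGroup = +ₚ-isAbelianGroup
      ; *-cong = λ {p} {p′} {q} e f → ≈-trans (*ₚ-congˡ q e) (*ₚ-congʳ p′ f)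
      ; *-assoc = *ₚ-assoc
      ; *-identity = *ₚ-identityˡ , λ p → ≈-trans (*ₚ-comm p 1ₚ) (*ₚ-identityˡ p)
      ; distrib = *ₚ-distribˡ , *ₚ-distribʳ }
    ; *-comm = *ₚ-comm } }

Poly-ring : AlmostCommutativeRing 0ℓ 0ℓ
Poly-ring = fromCommutativeRing Poly-commutativeRing (λ _ → nothing)

-- Orders of vanishing

record NonZero (p : Poly) : Set where
  constructor _,_
  field
    position  : ℕ
    coeff-set : coeff p position ≡ true

NonZero⇒≉0 : ∀ {p} → NonZero p → ¬ p ≈ 0ₚ
NonZero⇒≉0 (n , e) z with ≡.trans (≡.sym e) (at z n)
... | ()

NonZero-cong : ∀ {p q} → p ≈ q → NonZero p → NonZero q
NonZero-cong e (n , x) = n , ≡.trans (≡.sym (at e n)) x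

NonZero-∷ : ∀ {a p} → NonZero p → NonZero (a ∷ p)
NonZero-∷ (n , e) = suc n , e

NonZero-tail : ∀ {p} → NonZero (false ∷ p) → NonZero p
NonZero-tail (suc n , e) = n , e

nonZero? : ∀ p → NonZero p ⊎ p ≈ 0ₚ
nonZero? []          = inj₂ ≈-refl
nonZero? (true  ∷ p) = inj₁ (0 , refl)
nonZero? (false ∷ p) with nonZero? p
... | inj₁ np = inj₁ (NonZero-∷ np)
... | inj₂ e       = inj₂ (≈-trans (∷-cong refl e) false∷0≈0)

-- The order of vanishing at t = 0; the value on the zero polynomial is junk.
ord₀ : Poly → ℕ
ord₀ []          = 0
ord₀ (true  ∷ _) = 0
ord₀ (false ∷ p) = suc (ord₀ p)

ord₀-cong : ∀ {p q} → NonZero p → p ≈ q → ord₀ p ≡ ord₀ q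
ord₀-cong {true  ∷ p} {[]}    nz e with at e 0
... | ()
ord₀-cong {true  ∷ p} {b ∷ q} nz e with at e 0
... | refl = refl
ord₀-cong {false ∷ p} {[]}    nz e =
  ⊥-elim (NonZero⇒≉0 (NonZero-tail nz) (∷-injectiveʳ (≈-trans e (≈-sym false∷0≈0))))
ord₀-cong {false ∷ p} {b ∷ q} nz e with at e 0
... | refl = ≡.cong suc (ord₀-cong (NonZero-tail nz) (∷-injectiveʳ e))

lowest-*ₚ : ∀ p q → NonZero p → NonZero q →
            NonZero (p *ₚ q) × ord₀ (p *ₚ q) ≡ ord₀ p + ord₀ q
lowest-*ₚ (true ∷ p) q np nq = unit-*ₚ q nq
  where
  unit-*ₚ : ∀ q → NonZero q → NonZero ((true ∷ p) *ₚ q) × ord₀ ((true ∷ p) *ₚ q) ≡ ord₀ q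
  unit-*ₚ (true ∷ q)  nq = (0 , refl) , refl
  unit-*ₚ (false ∷ q) nq with unit-*ₚ q (NonZero-tail nq)
  ... | nz , ord≡ = NonZero-∷ (NonZero-cong tail≈ nz)
                  , ≡.cong suc (≡.trans (≡.sym (ord₀-cong nz tail≈)) ord≡)
    where
    tail≈ : (true ∷ p) *ₚ q ≈ q +ₚ p *ₚ (false ∷ q)
    tail≈ = +ₚ-cong ≈-refl (≈-sym (*ₚ-∷ʳ p false q))
lowest-*ₚ (false ∷ p) q np nq with lowest-*ₚ p q (NonZero-tail np) nq
... | nz , ord≡ = NonZero-∷ nz , ≡.cong suc ord≡

*ₚ-NonZero : ∀ {p q} → NonZero p → NonZero q → NonZero (p *ₚ q)
*ₚ-NonZero {p} {q} np nq = proj₁ (lowest-*ₚ p q np nq)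

NonZero-*ₚ⇒NonZeroˡ : ∀ p q → NonZero (p *ₚ q) → NonZero p
NonZero-*ₚ⇒NonZeroˡ p q npq with nonZero? p
... | inj₁ np  = np
... | inj₂ p≈0 = ⊥-elim (NonZero⇒≉0 npq (zero-*ₚ p q p≈0))

ord₀-*ₚ : ∀ {p q} → NonZero p → NonZero q → ord₀ (p *ₚ q) ≡ ord₀ p + ord₀ q
ord₀-*ₚ {p} {q} np nq = proj₂ (lowest-*ₚ p q np nq)

ord₀-+ₚ : ∀ {p q} → NonZero p → NonZero q → ord₀ p ≤ ord₀ (p +ₚ q) ⊎ ord₀ q ≤ ord₀ (p +ₚ q)
ord₀-+ₚ {true  ∷ p} {q}         np nq = inj₁ z≤n
ord₀-+ₚ {false ∷ p} {true  ∷ q} np nq = inj₂ z≤n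
ord₀-+ₚ {false ∷ p} {false ∷ q} np nq with ord₀-+ₚ (NonZero-tail np) (NonZero-tail nq)
... | inj₁ le = inj₁ (s≤s le)
... | inj₂ le = inj₂ (s≤s le)

*ₚ-cancelʳ : ∀ {a b c} → NonZero c → a *ₚ c ≈ b *ₚ c → a ≈ b
*ₚ-cancelʳ {a} {b} {c} nc e with nonZero? (a +ₚ b)
... | inj₁ nab = ⊥-elim (NonZero⇒≉0 (*ₚ-NonZero nab nc) (begin
  (a +ₚ b) *ₚ c      ≈⟨ *ₚ-distribʳ c a b ⟩
  a *ₚ c +ₚ b *ₚ c   ≈⟨ +ₚ-cong e ≈-refl ⟩
  b *ₚ c +ₚ b *ₚ c   ≈⟨ +ₚ-self (b *ₚ c) ⟩
  0ₚ                 ∎))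
  where open SetoidReasoning ≈-setoid
... | inj₂ a+b≈0 = begin
  a                  ≈⟨ +ₚ-identityʳ a ⟨
  a +ₚ 0ₚ            ≈⟨ +ₚ-cong ≈-refl (≈-trans (≈-sym (+ₚ-self b)) (+ₚ-comm b b)) ⟩
  a +ₚ (b +ₚ b)      ≈⟨ +ₚ-assoc a b b ⟨
  a +ₚ b +ₚ b        ≈⟨ +ₚ-cong a+b≈0 ≈-refl ⟩
  0ₚ +ₚ b            ∎
  where open SetoidReasoning ≈-setoid

t 1+t : Poly
t   = false ∷ true ∷ []
1+t = true ∷ true ∷ []

t-NonZero : NonZero t
t-NonZero = 1 , refl

∷-as-+ₚ : ∀ a p → (a ∷ []) +ₚ t *ₚ p ≈ a ∷ p
∷-as-+ₚ a p = ∷-cong (xor-identityʳ a) (*ₚ-identityˡ p)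

-- The substitution p(t) ↦ p(1 + t), which turns the order at t = 1 into the order at t = 0.
σ : Poly → Poly
σ []      = 0ₚ
σ (a ∷ p) = (a ∷ []) +ₚ 1+t *ₚ σ p

σ-zero : ∀ p → p ≈ 0ₚ → σ p ≈ 0ₚ
σ-zero []      e = ≈-refl
σ-zero (a ∷ p) e with at e 0
... | refl = ≈-trans (+ₚ-cong false∷0≈0 (*ₚ-congʳ 1+t (σ-zero p (∷-injectiveʳ (≈-trans e (≈-sym false∷0≈0))))))
                     (*ₚ-zeroʳ 1+t)

σ-cong : ∀ {p q} → p ≈ q → σ p ≈ σ q
σ-cong {[]}    {q}     e = ≈-sym (σ-zero q (≈-sym e))
σ-cong {a ∷ p} {[]}    e = σ-zero (a ∷ p) e
σ-cong {a ∷ p} {b ∷ q} e with at e 0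
... | refl = +ₚ-cong (≈-refl {a ∷ []}) (*ₚ-congʳ 1+t (σ-cong (∷-injectiveʳ e)))

σ-+ₚ : ∀ p q → σ (p +ₚ q) ≈ σ p +ₚ σ q
σ-+ₚ []      q       = ≈-refl
σ-+ₚ (a ∷ p) []      = ≈-sym (+ₚ-identityʳ _)
σ-+ₚ (a ∷ p) (b ∷ q) =
  ≈-trans (+ₚ-cong (≈-refl {(a xor b) ∷ []}) (*ₚ-congʳ 1+t (σ-+ₚ p q)))
          (regroup (a ∷ []) (b ∷ []) 1+t (σ p) (σ q))
  where
  regroup : ∀ A B U X Y → A +ₚ B +ₚ U *ₚ (X +ₚ Y) ≈ (A +ₚ U *ₚ X) +ₚ (B +ₚ U *ₚ Y)
  regroup = solve-∀ Poly-ring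

σ-*ₚ : ∀ p q → σ (p *ₚ q) ≈ σ p *ₚ σ q
σ-*ₚ []      q = ≈-refl
σ-*ₚ (a ∷ p) q =
  ≈-trans (σ-+ₚ (scale a q) (false ∷ (p *ₚ q)))
  (≈-trans (+ₚ-cong (σ-scale a) (+ₚ-cong false∷0≈0 (*ₚ-congʳ 1+t (σ-*ₚ p q))))
           (regroup (a ∷ []) 1+t (σ p) (σ q)))
  where
  σ-scale : ∀ a → σ (scale a q) ≈ (a ∷ []) *ₚ σ q
  σ-scale true  = ≈-sym (*ₚ-identityˡ (σ q))
  σ-scale false = ≈-sym (zero-*ₚ (false ∷ []) (σ q) false∷0≈0)
  regroup : ∀ A U X Y → A *ₚ Y +ₚ U *ₚ (X *ₚ Y) ≈ (A +ₚ U *ₚ X) *ₚ Y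
  regroup = solve-∀ Poly-ring

σ-1+t : σ 1+t ≈ t
σ-1+t = coeffwise λ { 0 → refl ; 1 → refl ; 2 → refl ; 3 → refl ; 4 → refl
                    ; (suc (suc (suc (suc (suc n))))) → refl }

σ-involutive : ∀ p → σ (σ p) ≈ p
σ-involutive []      = ≈-refl
σ-involutive (a ∷ p) = begin
  σ ((a ∷ []) +ₚ 1+t *ₚ σ p)                 ≈⟨ σ-+ₚ (a ∷ []) (1+t *ₚ σ p) ⟩
  σ (a ∷ []) +ₚ σ (1+t *ₚ σ p)               ≈⟨ +ₚ-cong (+ₚ-cong (≈-refl {a ∷ []}) (*ₚ-zeroʳ 1+t))
                                                        (≈-trans (σ-*ₚ 1+t (σ p)) (*ₚ-congˡ (σ (σ p)) σ-1+t)) ⟩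
  (a ∷ []) +ₚ 0ₚ +ₚ t *ₚ σ (σ p)             ≈⟨ +ₚ-cong (+ₚ-identityʳ (a ∷ [])) (*ₚ-congʳ t (σ-involutive p)) ⟩
  (a ∷ []) +ₚ t *ₚ p                         ≈⟨ ∷-as-+ₚ a p ⟩
  a ∷ p                                      ∎
  where open SetoidReasoning ≈-setoid

σ-NonZero : ∀ {p} → NonZero p → NonZero (σ p)
σ-NonZero {p} np with nonZero? (σ p)
... | inj₁ nσp = nσp
... | inj₂ σp≈0 = ⊥-elim (NonZero⇒≉0 np (≈-trans (≈-sym (σ-involutive p)) (σ-zero (σ p) σp≈0)))

record Valuation : Set where
  field
    ord      : Poly → ℕ
    ord-cong : ∀ {p q} → NonZero p → p ≈ q → ord p ≡ ord q
    ord-*ₚ   : ∀ {p q} → NonZero p → NonZero q → ord (p *ₚ q) ≡ ord p + ord q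
    ord-+ₚ   : ∀ {p q} → NonZero p → NonZero q → NonZero (p +ₚ q) →
               ord p ≤ ord (p +ₚ q) ⊎ ord q ≤ ord (p +ₚ q)

at-0 : Valuation
at-0 = record
  { ord = ord₀ ; ord-cong = ord₀-cong ; ord-*ₚ = ord₀-*ₚ ; ord-+ₚ = λ np nq _ → ord₀-+ₚ np nq }

ord₁ : Poly → ℕ
ord₁ p = ord₀ (σ p)

at-1 : Valuation
at-1 = record
  { ord      = ord₁
  ; ord-cong = λ np e → ord₀-cong (σ-NonZero np) (σ-cong e)
  ; ord-*ₚ   = λ {p} {q} np nq →
      ≡.trans (ord₀-cong (σ-NonZero (*ₚ-NonZero np nq)) (σ-*ₚ p q))
              (ord₀-*ₚ (σ-NonZero np) (σ-NonZero nq))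
  ; ord-+ₚ   = λ {p} {q} np nq np+q →
      ≡.subst (λ k → ord₀ (σ p) ≤ k ⊎ ord₀ (σ q) ≤ k)
              (≡.sym (ord₀-cong (σ-NonZero np+q) (σ-+ₚ p q)))
              (ord₀-+ₚ (σ-NonZero np) (σ-NonZero nq)) }

-- The field of rational functions 𝔽₂(t)

record Frac : Set where
  constructor frac
  field
    num         : Poly
    den         : Poly
    den-nonzero : NonZero den
open Frac

infix 4 _≃_
record _≃_ (x y : Frac) : Set where
  constructor cross
  field cross-≈ : num x *ₚ den y ≈ num y *ₚ den x
open _≃_

≃-refl : ∀ {x} → x ≃ x
≃-refl = cross ≈-refl

≃-sym : ∀ {x y} → x ≃ y → y ≃ x
≃-sym (cross e) = cross (≈-sym e)

≃-trans : ∀ {x y z} → x ≃ y → y ≃ z → x ≃ z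
≃-trans {frac nx dx _} {frac ny dy ndy} {frac nz dz _} (cross x≃y) (cross y≃z) =
  cross (*ₚ-cancelʳ ndy (begin
    nx *ₚ dz *ₚ dy   ≈⟨ solve (nx ∷ dy ∷ dz ∷ []) Poly-ring ⟩
    nx *ₚ dy *ₚ dz   ≈⟨ *ₚ-congˡ dz x≃y ⟩
    ny *ₚ dx *ₚ dz   ≈⟨ solve (ny ∷ dx ∷ dz ∷ []) Poly-ring ⟩
    ny *ₚ dz *ₚ dx   ≈⟨ *ₚ-congˡ dx y≃z ⟩
    nz *ₚ dy *ₚ dx   ≈⟨ solve (nz ∷ dy ∷ dx ∷ []) Poly-ring ⟩
    nz *ₚ dx *ₚ dy   ∎))
  where open SetoidReasoning ≈-setoid

≃-setoid : Setoid 0ℓ 0ℓ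
≃-setoid = record
  { Carrier = Frac ; _≈_ = _≃_
  ; isEquivalence = record { refl = ≃-refl ; sym = ≃-sym ; trans = ≃-trans } }

0ᶠ 1ᶠ : Frac
0ᶠ = frac 0ₚ 1ₚ (0 , refl)
1ᶠ = frac 1ₚ 1ₚ (0 , refl)

infixl 6 _+ᶠ_
_+ᶠ_ : Frac → Frac → Frac
frac nx dx ndx +ᶠ frac ny dy ndy = frac (nx *ₚ dy +ₚ ny *ₚ dx) (dx *ₚ dy) (*ₚ-NonZero ndx ndy)

+ᶠ-cong : ∀ {x x′ y y′} → x ≃ x′ → y ≃ y′ → x +ᶠ y ≃ x′ +ᶠ y′
+ᶠ-cong {frac nx dx _} {frac nx′ dx′ _} {frac ny dy _} {frac ny′ dy′ _} (cross ex) (cross ey) =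
  cross (begin
    (nx *ₚ dy +ₚ ny *ₚ dx) *ₚ (dx′ *ₚ dy′)
      ≈⟨ solve (nx ∷ dx ∷ ny ∷ dy ∷ dx′ ∷ dy′ ∷ []) Poly-ring ⟩
    nx *ₚ dx′ *ₚ (dy *ₚ dy′) +ₚ ny *ₚ dy′ *ₚ (dx *ₚ dx′)
      ≈⟨ +ₚ-cong (*ₚ-congˡ (dy *ₚ dy′) ex) (*ₚ-congˡ (dx *ₚ dx′) ey) ⟩
    nx′ *ₚ dx *ₚ (dy *ₚ dy′) +ₚ ny′ *ₚ dy *ₚ (dx *ₚ dx′)
      ≈⟨ solve (nx′ ∷ dx ∷ ny′ ∷ dy ∷ dx′ ∷ dy′ ∷ []) Poly-ring ⟩
    (nx′ *ₚ dy′ +ₚ ny′ *ₚ dx′) *ₚ (dx *ₚ dy) ∎)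
  where open SetoidReasoning ≈-setoid

+ᶠ-assoc : ∀ x y z → x +ᶠ y +ᶠ z ≃ x +ᶠ (y +ᶠ z)
+ᶠ-assoc (frac nx dx _) (frac ny dy _) (frac nz dz _) = cross (begin
  ((nx *ₚ dy +ₚ ny *ₚ dx) *ₚ dz +ₚ nz *ₚ (dx *ₚ dy)) *ₚ (dx *ₚ (dy *ₚ dz))
    ≈⟨ solve (nx ∷ dx ∷ ny ∷ dy ∷ nz ∷ dz ∷ []) Poly-ring ⟩
  (nx *ₚ (dy *ₚ dz) +ₚ (ny *ₚ dz +ₚ nz *ₚ dy) *ₚ dx) *ₚ (dx *ₚ dy *ₚ dz) ∎)
  where open SetoidReasoning ≈-setoid

+ᶠ-comm : ∀ x y → x +ᶠ y ≃ y +ᶠ x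
+ᶠ-comm (frac nx dx _) (frac ny dy _) = cross (begin
  (nx *ₚ dy +ₚ ny *ₚ dx) *ₚ (dy *ₚ dx) ≈⟨ solve (nx ∷ dx ∷ ny ∷ dy ∷ []) Poly-ring ⟩
  (ny *ₚ dx +ₚ nx *ₚ dy) *ₚ (dx *ₚ dy) ∎)
  where open SetoidReasoning ≈-setoid

+ᶠ-identityˡ : ∀ x → 0ᶠ +ᶠ x ≃ x
+ᶠ-identityˡ (frac nx dx _) = cross (begin
  nx *ₚ 1ₚ *ₚ dx   ≈⟨ solve (nx ∷ dx ∷ []) Poly-ring ⟩
  nx *ₚ (1ₚ *ₚ dx) ∎)
  where open SetoidReasoning ≈-setoid

+ᶠ-identityʳ : ∀ x → x +ᶠ 0ᶠ ≃ x
+ᶠ-identityʳ x = ≃-trans (+ᶠ-comm x 0ᶠ) (+ᶠ-identityˡ x)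

+ᶠ-self : ∀ x → x +ᶠ x ≃ 0ᶠ
+ᶠ-self (frac nx dx _) = cross (*ₚ-congˡ 1ₚ (+ₚ-self (nx *ₚ dx)))

infixl 7 _*ᶠ_ _⊙_
_*ᶠ_ : Frac → Bool → Frac
x *ᶠ true  = x
x *ᶠ false = 0ᶠ

*ᶠ-congˡ : ∀ {x y} a → x ≃ y → x *ᶠ a ≃ y *ᶠ a
*ᶠ-congˡ true  e = e
*ᶠ-congˡ false e = ≃-refl

*ᶠ-distribˡ : ∀ x a b → x *ᶠ (a xor b) ≃ x *ᶠ a +ᶠ x *ᶠ b
*ᶠ-distribˡ x true  true  = ≃-sym (+ᶠ-self x)
*ᶠ-distribˡ x true  false = ≃-sym (+ᶠ-identityʳ x)
*ᶠ-distribˡ x false true  = ≃-sym (+ᶠ-identityˡ x)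
*ᶠ-distribˡ x false false = ≃-sym (+ᶠ-identityˡ 0ᶠ)

*ᶠ-distribʳ : ∀ a x y → (x +ᶠ y) *ᶠ a ≃ x *ᶠ a +ᶠ y *ᶠ a
*ᶠ-distribʳ true  x y = ≃-refl
*ᶠ-distribʳ false x y = ≃-sym (+ᶠ-identityˡ 0ᶠ)

*ᶠ-assoc : ∀ x a b → x *ᶠ a *ᶠ b ≃ x *ᶠ (a ∧ b)
*ᶠ-assoc x true  b     = ≃-refl
*ᶠ-assoc x false true  = ≃-refl
*ᶠ-assoc x false false = ≃-refl

*ᶠ-zeroˡ : ∀ a → 0ᶠ *ᶠ a ≃ 0ᶠ
*ᶠ-zeroˡ true  = ≃-refl
*ᶠ-zeroˡ false = ≃-refl

_⊙_ : Frac → Poly → Frac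
x ⊙ p = frac (num x *ₚ p) (den x) (den-nonzero x)

⊙-cong : ∀ {x y} p → x ≃ y → x ⊙ p ≃ y ⊙ p
⊙-cong {frac nx dx _} {frac ny dy _} p (cross e) = cross (begin
  nx *ₚ p *ₚ dy   ≈⟨ solve (nx ∷ p ∷ dy ∷ []) Poly-ring ⟩
  nx *ₚ dy *ₚ p   ≈⟨ *ₚ-congˡ p e ⟩
  ny *ₚ dx *ₚ p   ≈⟨ solve (ny ∷ p ∷ dx ∷ []) Poly-ring ⟩
  ny *ₚ p *ₚ dx   ∎)
  where open SetoidReasoning ≈-setoid

⊙-congʳ : ∀ x {p q} → p ≈ q → x ⊙ p ≃ x ⊙ q
⊙-congʳ x e = cross (*ₚ-congˡ (den x) (*ₚ-congʳ (num x) e))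

⊙-cancelʳ : ∀ {x y p} → NonZero p → x ⊙ p ≃ y ⊙ p → x ≃ y
⊙-cancelʳ {frac nx dx _} {frac ny dy _} {p} np (cross e) = cross (*ₚ-cancelʳ np (begin
  nx *ₚ dy *ₚ p   ≈⟨ solve (nx ∷ p ∷ dy ∷ []) Poly-ring ⟩
  nx *ₚ p *ₚ dy   ≈⟨ e ⟩
  ny *ₚ p *ₚ dx   ≈⟨ solve (ny ∷ p ∷ dx ∷ []) Poly-ring ⟩
  ny *ₚ dx *ₚ p   ∎))
  where open SetoidReasoning ≈-setoid

+ᶠ-⊙ : ∀ x y p → (x +ᶠ y) ⊙ p ≃ x ⊙ p +ᶠ y ⊙ p
+ᶠ-⊙ (frac nx dx _) (frac ny dy _) p = cross (begin
  (nx *ₚ dy +ₚ ny *ₚ dx) *ₚ p *ₚ (dx *ₚ dy)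
    ≈⟨ solve (nx ∷ dx ∷ ny ∷ dy ∷ p ∷ []) Poly-ring ⟩
  (nx *ₚ p *ₚ dy +ₚ ny *ₚ p *ₚ dx) *ₚ (dx *ₚ dy) ∎)
  where open SetoidReasoning ≈-setoid

⊙-+ₚ : ∀ x p q → x ⊙ (p +ₚ q) ≃ x ⊙ p +ᶠ x ⊙ q
⊙-+ₚ (frac n d _) p q = cross (begin
  n *ₚ (p +ₚ q) *ₚ (d *ₚ d)            ≈⟨ solve (n ∷ d ∷ p ∷ q ∷ []) Poly-ring ⟩
  (n *ₚ p *ₚ d +ₚ n *ₚ q *ₚ d) *ₚ d    ∎)
  where open SetoidReasoning ≈-setoid

⊙-*ₚ : ∀ x p q → x ⊙ p ⊙ q ≃ x ⊙ (p *ₚ q)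
⊙-*ₚ (frac n d _) p q = cross (begin
  n *ₚ p *ₚ q *ₚ d     ≈⟨ solve (n ∷ d ∷ p ∷ q ∷ []) Poly-ring ⟩
  n *ₚ (p *ₚ q) *ₚ d   ∎)
  where open SetoidReasoning ≈-setoid

*ᶠ-as-⊙ : ∀ x a → x *ᶠ a ≃ x ⊙ (a ∷ [])
*ᶠ-as-⊙ x true  = cross (*ₚ-congˡ (den x) (≈-sym (≈-trans (*ₚ-comm (num x) 1ₚ) (*ₚ-identityˡ (num x)))))
*ᶠ-as-⊙ x false = cross (≈-sym (begin
  num x *ₚ (false ∷ []) *ₚ 1ₚ   ≈⟨ *ₚ-congˡ 1ₚ (*ₚ-congʳ (num x) false∷0≈0) ⟩
  num x *ₚ 0ₚ *ₚ 1ₚ             ≈⟨ *ₚ-congˡ 1ₚ (*ₚ-zeroʳ (num x)) ⟩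
  0ₚ                            ∎))
  where open SetoidReasoning ≈-setoid

_⊘_∣_ : Frac → (p : Poly) → NonZero p → Frac
x ⊘ p ∣ np = frac (num x) (den x *ₚ p) (*ₚ-NonZero (den-nonzero x) np)

⊘-⊙ : ∀ x p (np : NonZero p) → x ⊘ p ∣ np ⊙ p ≃ x
⊘-⊙ (frac n d _) p np = cross (begin
  n *ₚ p *ₚ d     ≈⟨ solve (n ∷ d ∷ p ∷ []) Poly-ring ⟩
  n *ₚ (d *ₚ p)   ∎)
  where open SetoidReasoning ≈-setoid

⊖-cross : ∀ a b c d → a + d ≡ c + b → a ⊖ b ≡ c ⊖ d
⊖-cross a b c d e = begin
  a ⊖ b               ≡⟨ ℤ.+-cancelˡ-⊖ d a b ⟨
  (d + a) ⊖ (d + b)   ≡⟨ ≡.cong₂ _⊖_ (≡.trans (ℕ.+-comm d a) (≡.trans e (ℕ.+-comm c b)))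
                                     (ℕ.+-comm d b) ⟩
  (b + c) ⊖ (b + d)   ≡⟨ ℤ.+-cancelˡ-⊖ b c d ⟩
  c ⊖ d               ∎
  where open ≡.≡-Reasoning

⊖-≤-shift : ∀ {a c} b e → a + e ≤ c → a ⊖ b ℤ.≤ c ⊖ (e + b)
⊖-≤-shift {a} {c} b e le = begin
  a ⊖ b               ≡⟨ ℤ.+-cancelˡ-⊖ e a b ⟨
  (e + a) ⊖ (e + b)   ≤⟨ ℤ.⊖-monoˡ-≤ (e + b) (≡.subst (_≤ c) (ℕ.+-comm a e) le) ⟩
  c ⊖ (e + b)         ∎
  where open ℤ.≤-Reasoning

≃-NonZero : ∀ {x y} → x ≃ y → NonZero (num x) → NonZero (num y)
≃-NonZero {x} {y} (cross e) nx with nonZero? (num y)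
... | inj₁ ny = ny
... | inj₂ y≈0 = ⊥-elim (NonZero⇒≉0 (*ₚ-NonZero nx (den-nonzero y))
                          (≈-trans e (zero-*ₚ (num y) (den x) y≈0)))

module FracValuation (V : Valuation) where
  open Valuation V

  ordᶠ : Frac → ℤ
  ordᶠ x = ord (num x) ⊖ ord (den x)

  ordᶠ-cong : ∀ {x y} → NonZero (num x) → x ≃ y → ordᶠ x ≡ ordᶠ y
  ordᶠ-cong {x} {y} nx x≃y@(cross e) =
    ⊖-cross (ord (num x)) (ord (den x)) (ord (num y)) (ord (den y)) (begin
    ord (num x) + ord (den y)     ≡⟨ ord-*ₚ nx (den-nonzero y) ⟨
    ord (num x *ₚ den y)          ≡⟨ ord-cong (*ₚ-NonZero nx (den-nonzero y)) e ⟩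
    ord (num y *ₚ den x)          ≡⟨ ord-*ₚ (≃-NonZero x≃y nx) (den-nonzero x) ⟩
    ord (num y) + ord (den x)     ∎)
    where open ≡.≡-Reasoning

  ordᶠ-⊙ : ∀ x {p} → NonZero (num x) → NonZero p → ordᶠ (x ⊙ p) ≡ + ord p ℤ.+ ordᶠ x
  ordᶠ-⊙ x {p} nx np = begin
    ord (num x *ₚ p) ⊖ ord (den x)        ≡⟨ ≡.cong (_⊖ ord (den x)) (ord-*ₚ nx np) ⟩
    (ord (num x) + ord p) ⊖ ord (den x)   ≡⟨ ≡.cong (_⊖ ord (den x)) (ℕ.+-comm (ord (num x)) (ord p)) ⟩
    (ord p + ord (num x)) ⊖ ord (den x)   ≡⟨ ℤ.distribʳ-⊖-+-pos (ord p) (ord (num x)) (ord (den x)) ⟨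
    + ord p ℤ.+ ordᶠ x                    ∎
    where open ≡.≡-Reasoning

  ordᶠ-+ᶠ : ∀ x y → NonZero (num x) → NonZero (num y) → NonZero (num (x +ᶠ y)) →
            ordᶠ x ℤ.≤ ordᶠ (x +ᶠ y) ⊎ ordᶠ y ℤ.≤ ordᶠ (x +ᶠ y)
  ordᶠ-+ᶠ (frac nx dx ndx) (frac ny dy ndy) nnx nny nN
    with ord-+ₚ (*ₚ-NonZero nnx ndy) (*ₚ-NonZero nny ndx) nN
  ... | inj₁ le = inj₁ (≡.subst (λ k → ord nx ⊖ ord dx ℤ.≤ ord N ⊖ k)
                    (≡.trans (ℕ.+-comm (ord dy) (ord dx)) (≡.sym (ord-*ₚ ndx ndy)))
                    (⊖-≤-shift (ord dx) (ord dy) (≡.subst (_≤ ord N) (ord-*ₚ nnx ndy) le)))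
    where N = nx *ₚ dy +ₚ ny *ₚ dx
  ... | inj₂ le = inj₂ (≡.subst (λ k → ord ny ⊖ ord dy ℤ.≤ ord N ⊖ k) (≡.sym (ord-*ₚ ndx ndy))
                    (⊖-≤-shift (ord dy) (ord dx) (≡.subst (_≤ ord N) (ord-*ₚ nny ndx) le)))
    where N = nx *ₚ dy +ₚ ny *ₚ dx

-- The valuation

Δ : Set
Δ = ℤ ±

τ : Δ → Δ
τ ⊥±    = ⊥±
τ [ k ] = [ ℤ.suc k ]
τ ⊤±    = ⊤±

τ-≤ : ∀ {γ δ} → γ ≤± δ → τ γ ≤± τ δ
τ-≤ {⊥±} {δ} _ = ⊥±≤ τ δ
τ-≤ [≤ le ]     = [≤ ℤ.suc-mono le ]
τ-≤ [ k ]≤⊤±    = [ ℤ.suc k ]≤⊤±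
τ-≤ ⊤±≤⊤±       = ⊤±≤⊤±

τ⁻¹ : Δ → Δ
τ⁻¹ ⊥±    = ⊥±
τ⁻¹ [ k ] = [ ℤ.pred k ]
τ⁻¹ ⊤±    = ⊤±

τ⁻¹-τ : ∀ γ → τ⁻¹ (τ γ) ≡ γ
τ⁻¹-τ ⊥±    = refl
τ⁻¹-τ [ k ] = ≡.cong [_] (ℤ.pred-suc k)
τ⁻¹-τ ⊤±    = refl

τ-injective : ∀ {γ δ} → τ γ ≡ τ δ → γ ≡ δ
τ-injective {γ} {δ} e = ≡.trans (≡.sym (τ⁻¹-τ γ)) (≡.trans (≡.cong τ⁻¹ e) (τ⁻¹-τ δ))

-- ⊥± is the only element τ does not move up, and nothing lies below it.
τ-moves-up-below : ∀ γ δ → ¬ γ ≡ ⊤± → τ γ ≤± γ → δ ≤± γ × ¬ δ ≡ γ → τ δ ≤± δ × ¬ τ δ ≡ δ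
τ-moves-up-below ⊥±    δ     _   _        (δ≤⊥ , δ≢⊥) = ⊥-elim (δ≢⊥ (≤±-antisym-≡ ℤ.≤-antisym δ≤⊥ (⊥±≤ δ)))
τ-moves-up-below [ k ] _     _   [≤ le ]  _         = ⊥-elim (ℤ.<-irrefl refl (ℤ.suc[i]≤j⇒i<j le))
τ-moves-up-below ⊤±    _     γ≢⊤ _        _         = ⊥-elim (γ≢⊤ refl)

value-chain : TauChain 0ℓ 0ℓ 0ℓ
value-chain = record
  { order   = record { isTotalOrder = ≤±-isTotalOrder-≡ ℤ.≤-isTotalOrder }
  ; ∞       = ⊤±
  ; ∞-max   = _≤⊤±
  ; τ       = τ
  ; τ-cong  = ≡.cong τ
  ; τ-mono  = λ (le , γ≢δ) → τ-≤ le , λ e → γ≢δ (τ-injective e)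
  ; τ-∞     = refl
  ; τ-chain = τ-moves-up-below }

open FracValuation at-0 using ()
  renaming (ordᶠ to ord₀ᶠ; ordᶠ-cong to ord₀ᶠ-cong; ordᶠ-⊙ to ord₀ᶠ-⊙; ordᶠ-+ᶠ to ord₀ᶠ-+ᶠ)
open FracValuation at-1 using ()
  renaming (ordᶠ to ord₁ᶠ; ordᶠ-cong to ord₁ᶠ-cong; ordᶠ-⊙ to ord₁ᶠ-⊙; ordᶠ-+ᶠ to ord₁ᶠ-+ᶠ)

ord₁ᶠ-⊙t : ∀ x → NonZero (num x) → ord₁ᶠ (x ⊙ t) ≡ ord₁ᶠ x
ord₁ᶠ-⊙t x nx = ≡.trans (ord₁ᶠ-⊙ x nx t-NonZero) (ℤ.+-identityˡ (ord₁ᶠ x))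

num≈0⇒≃0 : ∀ x → num x ≈ 0ₚ → x ≃ 0ᶠ
num≈0⇒≃0 _ z = cross (*ₚ-congˡ 1ₚ z)

zero-+ᶠ : ∀ x y → num x ≈ 0ₚ → x +ᶠ y ≃ y
zero-+ᶠ x y x≈0 = ≃-trans (+ᶠ-cong (num≈0⇒≃0 x x≈0) (≃-refl {y})) (+ᶠ-identityˡ y)

+ᶠ-zero : ∀ x y → num y ≈ 0ₚ → x +ᶠ y ≃ x
+ᶠ-zero x y y≈0 = ≃-trans (+ᶠ-comm x y) (zero-+ᶠ y x y≈0)

data Class (x : Frac) : Set where
  zero    : num x ≈ 0ₚ → Class x
  regular : NonZero (num x) → 0ℤ ℤ.≤ ord₁ᶠ x → Class x
  pole    : NonZero (num x) → ord₁ᶠ x ℤ.< 0ℤ → Class x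

classify : ∀ x → Class x
classify x with nonZero? (num x) | 0ℤ ℤ.≤? ord₁ᶠ x
... | inj₂ x≈0 | _      = zero x≈0
... | inj₁ nx  | yes r  = regular nx r
... | inj₁ nx  | no ¬r  = pole nx (ℤ.≰⇒> ¬r)

valueOf : ∀ {x} → Class x → Δ
valueOf     (zero _)      = ⊤±
valueOf {x} (regular _ _) = [ ord₀ᶠ x ]
valueOf     (pole _ _)    = ⊥±

v : Frac → Δ
v x = valueOf (classify x)

nonneg≢neg : ∀ {i j} → 0ℤ ℤ.≤ i → j ℤ.< 0ℤ → ¬ i ≡ j
nonneg≢neg r p refl = ℤ.≤⇒≯ r p

valueOf-cong : ∀ {x y} → x ≃ y → (c : Class x) (d : Class y) → valueOf c ≡ valueOf d
valueOf-cong e (zero _)       (zero _)       = refl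
valueOf-cong e (zero x≈0)     (regular ny _) = ⊥-elim (NonZero⇒≉0 (≃-NonZero (≃-sym e) ny) x≈0)
valueOf-cong e (zero x≈0)     (pole ny _)    = ⊥-elim (NonZero⇒≉0 (≃-NonZero (≃-sym e) ny) x≈0)
valueOf-cong e (regular nx _) (zero y≈0)     = ⊥-elim (NonZero⇒≉0 (≃-NonZero e nx) y≈0)
valueOf-cong e (pole nx _)    (zero y≈0)     = ⊥-elim (NonZero⇒≉0 (≃-NonZero e nx) y≈0)
valueOf-cong e (regular nx _) (regular _ _)  = ≡.cong [_] (ord₀ᶠ-cong nx e)
valueOf-cong e (regular nx r) (pole _ p)     = ⊥-elim (nonneg≢neg r p (ord₁ᶠ-cong nx e))
valueOf-cong e (pole _ p)     (regular ny r) = ⊥-elim (nonneg≢neg r p (ord₁ᶠ-cong ny (≃-sym e)))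
valueOf-cong e (pole _ _)     (pole _ _)     = refl

≡⇒≤± : ∀ {γ δ} → γ ≡ δ → γ ≤± δ
≡⇒≤± = ≤±-reflexive-≡ ℤ.≤-reflexive

v-cong : ∀ {x y} → x ≃ y → v x ≡ v y
v-cong {x} {y} e = valueOf-cong e (classify x) (classify y)

valueOf-+ᶠ : ∀ {x y} (c : Class x) (d : Class y) (e : Class (x +ᶠ y)) →
             valueOf c ≤± valueOf e ⊎ valueOf d ≤± valueOf e
valueOf-+ᶠ (pole _ _) _ e = inj₁ (⊥±≤ valueOf e)
valueOf-+ᶠ _ (pole _ _) e = inj₂ (⊥±≤ valueOf e)
valueOf-+ᶠ {x} {y} (zero x≈0) d e = inj₂ (≡⇒≤± (valueOf-cong (≃-sym (zero-+ᶠ x y x≈0)) d e))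
valueOf-+ᶠ {x} {y} c (zero y≈0) e = inj₁ (≡⇒≤± (valueOf-cong (≃-sym (+ᶠ-zero x y y≈0)) c e))
valueOf-+ᶠ (regular _ _) (regular _ _) (zero _) = inj₁ (_ ≤⊤±)
valueOf-+ᶠ {x} {y} (regular nx _) (regular ny _) (regular nxy _) =
  Sum.map [≤_] [≤_] (ord₀ᶠ-+ᶠ x y nx ny nxy)
valueOf-+ᶠ {x} {y} (regular nx rx) (regular ny ry) (pole nxy p) with ord₁ᶠ-+ᶠ x y nx ny nxy
... | inj₁ le = ⊥-elim (ℤ.≤⇒≯ (ℤ.≤-trans rx le) p)
... | inj₂ le = ⊥-elim (ℤ.≤⇒≯ (ℤ.≤-trans ry le) p)

valueOf-⊙t : ∀ {x} (c : Class x) (d : Class (x ⊙ t)) → valueOf d ≡ τ (valueOf c)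
valueOf-⊙t     (zero _)       (zero _)       = refl
valueOf-⊙t     (zero x≈0)     (regular nxt _) = ⊥-elim (NonZero⇒≉0 nxt (*ₚ-congˡ t x≈0))
valueOf-⊙t     (zero x≈0)     (pole nxt _)   = ⊥-elim (NonZero⇒≉0 nxt (*ₚ-congˡ t x≈0))
valueOf-⊙t     (regular nx _) (zero xt≈0)    = ⊥-elim (NonZero⇒≉0 (*ₚ-NonZero nx t-NonZero) xt≈0)
valueOf-⊙t     (pole nx _)    (zero xt≈0)    = ⊥-elim (NonZero⇒≉0 (*ₚ-NonZero nx t-NonZero) xt≈0)
valueOf-⊙t {x} (regular nx _) (regular _ _)  = ≡.cong [_] (ord₀ᶠ-⊙ x nx t-NonZero)
valueOf-⊙t {x} (regular nx r) (pole _ p)     = ⊥-elim (nonneg≢neg r p (≡.sym (ord₁ᶠ-⊙t x nx)))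
valueOf-⊙t {x} (pole nx p)    (regular _ r)  = ⊥-elim (nonneg≢neg r p (ord₁ᶠ-⊙t x nx))
valueOf-⊙t     (pole _ _)     (pole _ _)     = refl

v-+ᶠ : ∀ x y → v x ≤± v (x +ᶠ y) ⊎ v y ≤± v (x +ᶠ y)
v-+ᶠ x y = valueOf-+ᶠ (classify x) (classify y) (classify (x +ᶠ y))

v-⊙t : ∀ x → v (x ⊙ t) ≡ τ (v x)
v-⊙t x = valueOf-⊙t (classify x) (classify (x ⊙ t))

valueOf≡⊤⇒≃0 : ∀ {x} (c : Class x) → valueOf c ≡ ⊤± → x ≃ 0ᶠ
valueOf≡⊤⇒≃0 {x} (zero x≈0) _ = num≈0⇒≃0 x x≈0

v-regular : ∀ x → NonZero (num x) → 0ℤ ℤ.≤ ord₁ᶠ x → v x ≡ [ ord₀ᶠ x ]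
v-regular x nx r = valueOf-cong ≃-refl (classify x) (regular nx r)

v-pole : ∀ x → NonZero (num x) → ord₁ᶠ x ℤ.< 0ℤ → v x ≡ ⊥±
v-pole x nx p = valueOf-cong ≃-refl (classify x) (pole nx p)

t^ : ℕ → Poly
t^ zero    = 1ₚ
t^ (suc k) = false ∷ t^ k

t^-NonZero : ∀ k → NonZero (t^ k)
t^-NonZero zero    = 0 , refl
t^-NonZero (suc k) = NonZero-∷ (t^-NonZero k)

ord₀-t^ : ∀ k → ord₀ (t^ k) ≡ k
ord₀-t^ zero    = refl
ord₀-t^ (suc k) = ≡.cong suc (ord₀-t^ k)

ord₁-t^ : ∀ k → ord₁ (t^ k) ≡ 0
ord₁-t^ zero    = refl
ord₁-t^ (suc k) = begin
  ord₁ (t^ (suc k))    ≡⟨ Valuation.ord-cong at-1 (t^-NonZero (suc k))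
                                                  (∷-cong refl (≈-sym (*ₚ-identityˡ (t^ k)))) ⟩
  ord₁ (t *ₚ t^ k)     ≡⟨ Valuation.ord-*ₚ at-1 t-NonZero (t^-NonZero k) ⟩
  ord₁ t + ord₁ (t^ k) ≡⟨ ord₁-t^ k ⟩
  0                    ∎
  where open ≡.≡-Reasoning

v-t^/t^ : ∀ a b → v (frac (t^ a) (t^ b) (t^-NonZero b)) ≡ [ a ⊖ b ]
v-t^/t^ a b = ≡.trans (v-regular _ (t^-NonZero a) no-pole)
                      (≡.cong [_] (≡.cong₂ _⊖_ (ord₀-t^ a) (ord₀-t^ b)))
  where
  no-pole : 0ℤ ℤ.≤ ord₁ (t^ a) ⊖ ord₁ (t^ b)
  no-pole = ≡.subst (0ℤ ℤ.≤_) (≡.sym (≡.cong₂ _⊖_ (ord₁-t^ a) (ord₁-t^ b))) ℤ.≤-refl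

v-surjective : ∀ γ → Σ Frac λ x → v x ≡ γ
v-surjective ⊥±            = x , v-pole x (0 , refl) ℤ.-<+
  where x = frac 1ₚ 1+t (0 , refl)
v-surjective [ + n ]       = _ , v-t^/t^ n 0
v-surjective [ ℤ.-[1+ n ] ] = _ , v-t^/t^ 0 (suc n)
v-surjective ⊤±            = 0ᶠ , refl

-- The counterexample

𝔽₂ : Field 0ℓ 0ℓ
𝔽₂ = record
  { commutativeRing = xor-∧-commutativeRing
  ; 0≉1             = λ ()
  ; inverse         = λ { true _ → true , refl ; false false≉0 → ⊥-elim (false≉0 refl) } }

id𝔽₂ : Endomorphism 𝔽₂
id𝔽₂ = (λ a → a) , Identity.isRingHomomorphism _ refl

𝔽₂⟮t⟯ : RightModule (Field.ring 𝔽₂) 0ℓ 0ℓ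
𝔽₂⟮t⟯ = record
  { Carrierᴹ = Frac
  ; _≈ᴹ_     = _≃_
  ; _+ᴹ_     = _+ᶠ_
  ; _*ᵣ_     = _*ᶠ_
  ; 0ᴹ       = 0ᶠ
  ; -ᴹ_      = λ x → x
  ; isRightModule = record
    { isRightSemimodule = record
      { +ᴹ-isCommutativeMonoid = record
        { isMonoid = record
          { isSemigroup = record
            { isMagma = record { isEquivalence = Setoid.isEquivalence ≃-setoid ; ∙-cong = +ᶠ-cong }
            ; assoc = +ᶠ-assoc }
          ; identity = +ᶠ-identityˡ , +ᶠ-identityʳ }
        ; comm = +ᶠ-comm }
      ; isPrerightSemimodule = record
        { *ᵣ-cong       = λ { {_} {_} {a} e refl → *ᶠ-congˡ a e }
        ; *ᵣ-zeroʳ      = λ x → ≃-refl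
        ; *ᵣ-distribˡ   = *ᶠ-distribˡ
        ; *ᵣ-identityʳ  = λ x → ≃-refl
        ; *ᵣ-assoc      = *ᶠ-assoc
        ; *ᵣ-zeroˡ      = *ᶠ-zeroˡ
        ; *ᵣ-distribʳ   = *ᶠ-distribʳ } }
    ; -ᴹ‿cong    = λ e → e
    ; -ᴹ‿inverse = +ᶠ-self , +ᶠ-self } }

𝔽₂⟮t⟯-skew : SkewModule 𝔽₂ id𝔽₂ 0ℓ 0ℓ
𝔽₂⟮t⟯-skew = record
  { kmodule  = 𝔽₂⟮t⟯
  ; _·t      = _⊙ t
  ; ·t-cong  = ⊙-cong t
  ; ·t-+     = λ x y → +ᶠ-⊙ x y t
  ; ·t-twist = λ { x true → ≃-refl ; x false → ≃-refl } }

open SkewModule 𝔽₂⟮t⟯-skew using (_·_)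

·-as-⊙ : ∀ y r → y · r ≃ y ⊙ r
·-as-⊙ y []       = ≃-sym (num≈0⇒≃0 (y ⊙ []) (*ₚ-zeroʳ (num y)))
·-as-⊙ y (a ∷ as) = begin
  y *ᶠ a +ᶠ (y ⊙ t) · as          ≈⟨ +ᶠ-cong (*ᶠ-as-⊙ y a) (·-as-⊙ (y ⊙ t) as) ⟩
  y ⊙ (a ∷ []) +ᶠ y ⊙ t ⊙ as      ≈⟨ +ᶠ-cong (≃-refl {y ⊙ (a ∷ [])}) (⊙-*ₚ y t as) ⟩
  y ⊙ (a ∷ []) +ᶠ y ⊙ (t *ₚ as)   ≈⟨ ⊙-+ₚ y (a ∷ []) (t *ₚ as) ⟨
  y ⊙ ((a ∷ []) +ₚ t *ₚ as)       ≈⟨ ⊙-congʳ y (∷-as-+ₚ a as) ⟩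
  y ⊙ (a ∷ as)                    ∎
  where open SetoidReasoning ≃-setoid

v-scalar : ∀ x a → ¬ a ≡ false → v (x *ᶠ a) ≡ v x
v-scalar x true  _       = refl
v-scalar x false false≢0 = ⊥-elim (false≢0 refl)

𝔽₂⟮t⟯-valued : ValuedModule 𝔽₂ id𝔽₂ 0ℓ 0ℓ 0ℓ 0ℓ 0ℓ
𝔽₂⟮t⟯-valued = record
  { module′      = 𝔽₂⟮t⟯-skew
  ; chain        = value-chain
  ; v            = v
  ; v-cong       = v-cong
  ; v-surj       = v-surjective
  ; v-∞⇒0        = λ x → valueOf≡⊤⇒≃0 (classify x)
  ; 0⇒v-∞        = λ _ → v-cong
  ; v-+          = v-+ᶠ
  ; v--          = v-+ᶠ
  ; ·t-injective = ⊙-cancelʳ t-NonZero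
  ; v-scalar     = v-scalar
  ; v-t          = v-⊙t }

open ValuedModule 𝔽₂⟮t⟯-valued using (Divisible; Henselian; _>θ)

NonZeroPoly⇒NonZero : ∀ r → NonZeroPoly 𝔽₂ id𝔽₂ r → NonZero r
NonZeroPoly⇒NonZero (true  ∷ r) (here _)       = 0 , refl
NonZeroPoly⇒NonZero (false ∷ r) (here false≢0) = ⊥-elim (false≢0 refl)
NonZeroPoly⇒NonZero (a     ∷ r) (there nr)     = NonZero-∷ (NonZeroPoly⇒NonZero r nr)

divisible : Divisible
divisible r nr x = x ⊘ r ∣ nz , ≃-trans (·-as-⊙ (x ⊘ r ∣ nz) r) (⊘-⊙ x r nz)
  where nz = NonZeroPoly⇒NonZero r nr

suc≡0⇒<0 : ∀ {i} → ℤ.suc i ≡ 0ℤ → i ℤ.< 0ℤ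
suc≡0⇒<0 {i} e = ≡.subst (ℤ._< 0ℤ) (≡.trans (≡.cong ℤ.pred (≡.sym e)) (ℤ.pred-suc i)) ℤ.-<+

⊙1+t≃1⇒v≡⊥± : ∀ y → y ⊙ 1+t ≃ 1ᶠ → v y ≡ ⊥±
⊙1+t≃1⇒v≡⊥± y e = v-pole y ny (suc≡0⇒<0 (begin
  ℤ.suc (ord₁ᶠ y)    ≡⟨ ord₁ᶠ-⊙ y ny (0 , refl) ⟨
  ord₁ᶠ (y ⊙ 1+t)    ≡⟨ ord₁ᶠ-cong ny1+t e ⟩
  0ℤ                 ∎))
  where
  open ≡.≡-Reasoning
  ny1+t : NonZero (num y *ₚ 1+t)
  ny1+t = ≃-NonZero (≃-sym e) (0 , refl)
  ny : NonZero (num y)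
  ny = NonZero-*ₚ⇒NonZeroˡ (num y) 1+t ny1+t

v≡⊥±⇒¬>θ : ∀ y → v y ≡ ⊥± → ¬ y >θ
v≡⊥±⇒¬>θ y vy≡⊥ y>θ rewrite vy≡⊥ with y>θ
... | inj₁ (_ , ⊥≢⊥) = ⊥≢⊥ refl

1ᶠ>θ : 1ᶠ >θ
1ᶠ>θ = inj₁ ([≤ ℤ.+≤+ z≤n ] , λ ())

not-henselian : ¬ Henselian
not-henselian henselian with henselian 1+t (λ ()) 1ᶠ 1ᶠ>θ
... | y , y>θ , y·[1+t]≃1 =
  v≡⊥±⇒¬>θ y (⊙1+t≃1⇒v≡⊥± y (≃-trans (≃-sym (·-as-⊙ y 1+t)) y·[1+t]≃1)) y>θ

mainTheorem8 : Σ (Field 0ℓ 0ℓ) λ K → Σ (Endomorphism K) λ φ →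
                 Σ (ValuedModule K φ 0ℓ 0ℓ 0ℓ 0ℓ 0ℓ) λ M →
                   ValuedModule.Divisible M × ¬ ValuedModule.Henselian M
mainTheorem8 = 𝔽₂ , id𝔽₂ , 𝔽₂⟮t⟯-valued , divisible , not-henselian
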